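{- Let $n\ge 1$. With the convention that, when $n$ is odd, both $Y_n$ and $Z_n$ send $\pi_n$ to $\pi_n$, we have $Y_n(\sigma)=Z_n(\sigma)=\zeta_n(\overline{\alpha}_n(\sigma))$ for every $\sigma\in\overline{D}_n$; that is, the map $Y_n$ obtained by subtracting $A_n$ from $H_n$ equals $\zeta_n\circ\overline{\alpha}_n$.
   Context: For $n \geq 0$ let $\mathfrak{S}_n$ be the set of permutations of $[n]=\{1,\dots,n\}$ ($\mathfrak{S}_0$ consists of the empty permutation $()$), written in disjoint cycle notation. Let $D_n\subseteq \mathfrak{S}_n$ be the set of derangements (permutations with no fixed point), $E_n \subseteq \mathfrak{S}_n$ the set of permutations with exactly one fixed point, $\overline{D}_n=\mathfrak{S}_n\setminus D_n$ and $\overline{E}_n=\mathfrak{S}_n\setminus E_n$. Define $\pi_n = (1\,2)(3\,4)\cdots(n-1\;n)$ if $n$ is even and $\pi_n=(1\,2)(3\,4)\cdots(n-2\;\,n-1)(n)$ if $n$ is odd; so $\pi_0=()$, $\pi_1=(1)$, $\pi_n\in D_n$ for $n$ even and $\pi_n \in E_n$ for $n$ odd. Let $\Pi_n=\{\pi_n\}$. For $\sigma\in\mathfrak{S}_n$ and $a\in[n]$, $\sigma\setminus a$ denotes the permutation of $[n]\setminus\{a\}$ obtained by deleting $a$ from the disjoint cycle decomposition of $\sigma$: $(\sigma\setminus a)(x)=\sigma(x)$ if $\sigma(x)\neq a$, and $(\sigma\setminus a)(\sigma^{ -1}(a))=\sigma(a)$ if $\sigma(a)\ne a$. In particular $\sigma\setminus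 n\in\mathfrak{S}_{n-1}$. For $n\ge 1$ define the bijection $f_n:[n]\times D_{n-1}\to E_n$ by: for $m<n$, $f_n(m,\sigma)$ is the permutation $\tau$ of $[n]$ obtained by replacing $m$ by $n$ in the cycle decomposition of $\sigma$ and adding the fixed point $m$ (i.e. $\tau(m)=m$, $\tau(\sigma^{ -1}(m))=n$, $\tau(n)=\sigma(m)$, $\tau(x)=\sigma(x)$ otherwise); and $f_n(n,\sigma)$ is $\sigma$ with the fixed point $n$ appended. Define bijections $\alpha_n$ recursively: for $n$ even, $\alpha_n: D_n\to E_n\sqcup \Pi_n$; for $n$ odd, $\alpha_n: D_n\sqcup\Pi_n\to E_n$ (these unions are disjoint). Let $\alpha_0$ send $()$ to $\pi_0$ and $\alpha_1$ send $\pi_1$ to $(1)$. For $n\ge 2$ and $\sigma$ in the domain of $\alpha_n$, with $\alpha_{n-1}^{ -1}$ the inverse of the bijection $\alpha_{n-1}$: (i) if $\sigma\in D_n$ and $n$ lies in a cycle of $\sigma$ of length at least $3$, then $\alpha_n(\sigma)=f_n(\sigma(n),\sigma\setminus n)$; (ii) if $\sigma\in D_n$ and $n$ lies in a $2$-cycle of $\sigma$, then $\sigma\setminus n\in E_{n-1}$; let $\rho=\alpha_{n-1}^{ -1}(\sigma\setminus n)$. If $\rho\in D_{n-1}$, then $\alpha_n(\sigma)=f_n(n,\rho)$; if $\rho=\pi_{n-1}\in\Pi_{n-1}$ (possible only for $n$ even), then $\alpha_n(\sigma)=\pi_n\in\Pi_n$; (iii) if $n$ is odd and $\sigma=\pi_n\in\Pi_n$,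 then $\alpha_n(\pi_n)=f_n\big(n,\alpha_{n-1}^{ -1}(\pi_{n-1})\big)$, where $\pi_{n-1}$ is regarded as the element of $\Pi_{n-1}$ in the domain of $\alpha_{n-1}^{ -1}$. Let $A_n=f_n^{ -1}\circ\alpha_n$, with $\pi_n\in\Pi_n$ sent to itself when $n$ is even; so $A_n:D_n\to([n]\times D_{n-1})\sqcup\Pi_n$ for $n$ even and $A_n:D_n\sqcup\Pi_n\to[n]\times D_{n-1}$ for $n$ odd. Let $H_n:\mathfrak{S}_n\to[n]\times\mathfrak{S}_{n-1}$, $H_n(\sigma)=(\sigma(n),\sigma\setminus n)$ (a bijection). The map $Y_n=H_n\setminus A_n$ (involution-principle subtraction) is defined on $\sigma\in\overline{D}_n$ (with $\sigma\ne\pi_n$ if $n$ is odd) as follows: put $y_0=H_n(\sigma)$; while $y_k\in[n]\times D_{n-1}$, put $y_{k+1}=H_n(A_n^{ -1}(y_k))$; then $Y_n(\sigma)$ is the first $y_k$ not in $[n]\times D_{n-1}$ (this process terminates). Define $\overline{\alpha}_n$ on $\overline{D}_n$ by $\overline{\alpha}_n(\sigma)=\sigma$ if $\sigma\in\overline{E}_n$ and $\overline{\alpha}_n(\sigma)=\alpha_n^{ -1}(\sigma)$ if $\sigma\in E_n$ (for $n$ odd, $\overline\alpha_n(\pi_n)=\pi_n$). Define $\zeta_n:\overline{E}_n\to[n]\times\overline{D}_{n-1}$ by $\zeta_n(\sigma)=(\sigma(n),\sigma\setminus n)$ if $\sigma\in\overline{D}_n$ or if $\sigma\in D_n$ with $n$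 in a $2$-cycle; and, if $\sigma\in D_n$ with $n$ in a cycle of length at least $3$, $\zeta_n(\sigma)=(\sigma(\sigma(n)),\rho)$ where $\rho\in\mathfrak{S}_{n-1}$ is obtained by removing $n$ and $\sigma(n)$ from the cycle decomposition of $\sigma$ and adding $\sigma(n)$ as a fixed point (i.e. $\rho(\sigma^{ -1}(n))=\sigma(\sigma(n))$, $\rho(\sigma(n))=\sigma(n)$, $\rho(x)=\sigma(x)$ otherwise). Let $Z_n=\zeta_n\circ\overline{\alpha}_n$ on $\overline{D}_n$ (with $\pi_n\mapsto\pi_n$ when $n$ is odd). -}

module Defs where

-- Permutations of [n] are represented by their value tables: a vector
-- σ : Vec (Fin n) n with σ(x) = lookup σ x, required to be injective.
-- The element i : Fin n stands for i+1 ∈ [n]; the top element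
-- fromℕ m : Fin (suc m) stands for n = m+1, and inject₁ embeds [n-1] into [n].

open import Data.Nat using (ℕ; zero; suc)
open import Data.Bool using (Bool; true; false; if_then_else_; not)
open import Data.Fin using (Fin; zero; suc; fromℕ; inject₁)
open import Data.Fin.Properties using (all?) renaming (_≟_ to _≟F_)
open import Data.Vec using (Vec; []; _∷_; lookup; tabulate)
open import Data.Vec.Properties using (≡-dec)
open import Data.List using (List; []; _∷_; _++_; map; concatMap; filter; length; allFin)
open import Data.Maybe using (Maybe; just; nothing)
open import Data.Product using (_×_; _,_; proj₁; proj₂)
open import Relation.Binary.PropositionalEquality using (_≡_; refl; _≢_)
open import Relation.Nullary using (¬_; Dec; yes; no; does; _→-dec_)
open import Relation.Nullary.Decidable using (⌊_⌋)

Perm : ℕ → Set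
Perm n = Vec (Fin n) n

IsPerm : ∀ {n} → Perm n → Set
IsPerm {n} σ = (x y : Fin n) → lookup σ x ≡ lookup σ y → x ≡ y

isPerm? : ∀ {n} (σ : Perm n) → Dec (IsPerm σ)
isPerm? σ = all? (λ x → all? (λ y → (lookup σ x ≟F lookup σ y) →-dec (x ≟F y)))

nfix : ∀ {n} → Perm n → ℕ
nfix {n} σ = length (filter (λ x → lookup σ x ≟F x) (allFin n))

Derangement : ∀ {n} → Perm n → Set
Derangement σ = nfix σ ≡ 0

OneFixed : ∀ {n} → Perm n → Set
OneFixed σ = nfix σ ≡ 1

isDer : ∀ {n} → Perm n → Bool
isDer σ = ⌊ nfix σ Data.Nat.≟ 0 ⌋

isE : ∀ {n} → Perm n → Bool
isE σ = ⌊ nfix σ Data.Nat.≟ 1 ⌋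

odd : ℕ → Bool
odd zero = false
odd (suc n) = not (odd n)

piF : (n : ℕ) → Fin n → Fin n
piF (suc zero) zero = zero
piF (suc (suc n)) zero = suc zero
piF (suc (suc n)) (suc zero) = zero
piF (suc (suc n)) (suc (suc i)) = suc (suc (piF n i))

π : (n : ℕ) → Perm n
π n = tabulate (piF n)

split : ∀ {m} → Fin (suc m) → Maybe (Fin m)
split {zero} zero = nothing
split {suc m} zero = just zero
split {suc m} (suc i) with split i
... | just j = just (suc j)
... | nothing = nothing

-- lower an element known (in the intended use) to be < n; d is a dummy default
lowerOr : ∀ {m} → Fin m → Fin (suc m) → Fin m
lowerOr d i with split i
... | just j = j
... | nothing = d

top : ∀ {m} → Fin (suc m)
top {m} = fromℕ m

_==_ : ∀ {n} → Fin n → Fin n → Bool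
i == j = ⌊ i ≟F j ⌋

-- σ ∖ n  (deleting n from the cycle decomposition)

delTop : ∀ {m} → Perm (suc m) → Perm m
delTop σ = tabulate λ x →
  let y = lookup σ (inject₁ x) in
  if y == top then lowerOr x (lookup σ top) else lowerOr x y

H : ∀ {m} → Perm (suc m) → Fin (suc m) × Perm m
H σ = lookup σ top , delTop σ

-- f_n : [n] × D_{n-1} → E_n
fF : ∀ {m} → Fin (suc m) → Perm m → Fin (suc m) → Fin (suc m)
fF a ρ y with split a
fF a ρ y | nothing with split y
... | nothing = top
... | just x = inject₁ (lookup ρ x)
fF a ρ y | just a' with split y
... | nothing = inject₁ (lookup ρ a')
... | just x = if x == a' then a
               else (if lookup ρ x == a' then top else inject₁ (lookup ρ x))

f : ∀ {m} → Fin (suc m) × Perm m → Perm (suc m)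
f {m} (a , ρ) = tabulate (fF a ρ)

-- Domains/codomains of α_n: a permutation, or the formal element π_n of
-- the disjoint copy Π_n; bad is a junk value for out-of-domain inputs.

data PX (n : ℕ) : Set where
  perm : Perm n → PX n
  pi   : PX n
  bad  : PX n

_≟X_ : ∀ {n} (x y : PX n) → Dec (x ≡ y)
perm σ ≟X perm τ with ≡-dec _≟F_ σ τ
... | yes refl = yes refl
... | no ne = no λ { refl → ne refl }
perm _ ≟X pi = no λ ()
perm _ ≟X bad = no λ ()
pi ≟X perm _ = no λ ()
pi ≟X pi = yes refl
pi ≟X bad = no λ ()
bad ≟X perm _ = no λ ()
bad ≟X pi = no λ ()
bad ≟X bad = yes refl

allVecs : (n k : ℕ) → List (Vec (Fin n) k)
allVecs n zero = [] ∷ []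
allVecs n (suc k) = concatMap (λ v → map (_∷ v) (allFin n)) (allVecs n k)

allDer : (n : ℕ) → List (Perm n)
allDer n = filter (λ σ → isPerm? σ Relation.Nullary.×-dec (nfix σ Data.Nat.≟ 0)) (allVecs n n)

domα : (n : ℕ) → List (PX n)
domα n = (if odd n then pi ∷ [] else []) ++ map perm (allDer n)

invBy : ∀ {n} → (PX n → PX n) → List (PX n) → PX n → PX n
invBy g [] t = bad
invBy g (c ∷ cs) t with g c ≟X t
... | yes _ = c
... | no _ = invBy g cs t

mutual
  α : (n : ℕ) → PX n → PX n
  α zero (perm _) = pi
  α zero _ = bad
  α (suc zero) pi = perm (zero ∷ [])
  α (suc zero) _ = bad
  α (suc (suc k)) (perm σ) =
    if lookup σ (lookup σ top) == top
    then -- (ii): n in a 2-cycle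
      (case2 (αInv (suc k) (perm (delTop σ))))
    else -- (i): n in a cycle of length ≥ 3
      perm (f (lookup σ top , delTop σ))
    where
    case2 : PX (suc k) → PX (suc (suc k))
    case2 (perm ρ) = perm (f (top , ρ))
    case2 pi = pi
    case2 bad = bad
  α (suc (suc k)) pi = if odd (suc (suc k)) then case3 (αInv (suc k) pi) else bad
    where
    case3 : PX (suc k) → PX (suc (suc k))
    case3 (perm ρ) = perm (f (top , ρ))
    case3 _ = bad
  α (suc (suc k)) bad = bad

  αInv : (n : ℕ) → PX n → PX n
  αInv n = invBy (α n) (domα n)

-- A_n^{-1} = α_n^{-1} ∘ f_n  (since A_n = f_n^{-1} ∘ α_n)
AInv : ∀ {m} → Fin (suc m) × Perm m → PX (suc m)
AInv y = αInv _ (perm (f y))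

asPerm : ∀ {n} → PX n → Maybe (Perm n)
asPerm (perm σ) = just σ
asPerm {n} pi = just (π n)
asPerm bad = nothing

-- Y_n = H_n ∖ A_n, as a (deterministic) relation:
-- Runs y z  means: the iteration started at y_0 = y terminates with value z.

data Runs {m : ℕ} : Fin (suc m) × Perm m → Fin (suc m) × Perm m → Set where
  stop : ∀ {y} → ¬ Derangement (proj₂ y) → Runs y y
  next : ∀ {y z} (σ' : Perm (suc m)) → Derangement (proj₂ y) →
         asPerm (AInv y) ≡ just σ' → Runs (H σ') z → Runs y z

αbar : ∀ {n} → Perm n → PX n
αbar {n} σ = if isE σ then αInv n (perm σ) else perm σ

ζρ : ∀ {m} → Perm (suc m) → Perm m
ζρ σ = tabulate λ x →
  let y = inject₁ x in
  if lookup σ y == top then lowerOr x (lookup σ (lookup σ top))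
  else (if y == lookup σ top then x else lowerOr x (lookup σ y))

ζ : ∀ {m} → Perm (suc m) → Fin (suc m) × Perm m
ζ σ = if isDer σ then
        (if lookup σ (lookup σ top) == top then H σ
         else (lookup σ (lookup σ top) , ζρ σ))
      else H σ

ζX : ∀ {m} → PX (suc m) → Maybe (Fin (suc m) × Perm m)
ζX (perm σ) = just (ζ σ)
ζX _ = nothing

Z : ∀ {m} → Perm (suc m) → Maybe (Fin (suc m) × Perm m)
Z σ = ζX (αbar σ)

-- Everything is decided by at most one step of the involution-principle
-- iteration.  If σ has a fixed point below n, then σ ∖ n is no derangement and
-- the iteration stops at once at H_n(σ) = ζ_n(σ).  Otherwise σ ∈ E_n and
-- τ = α_n⁻¹(σ) is a derangement.  If n lies in a cycle of length ≥ 3 of τ, then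
-- σ = f_n(τ(n), τ ∖ n) and H_n(σ) = ζ_n(τ), whose second component fixes τ(n),
-- so again the iteration stops.  If n lies in a 2-cycle, then σ = f_n(n, ρ) with
-- ρ a derangement; one step leads to H_n(A_n⁻¹(n, ρ)) = H_n(τ) = ζ_n(τ), and
-- there it stops because τ ∖ n ∈ E_{n-1}.
-- Since α_n⁻¹ is computed by search, the real content is that α_n is a bijection
-- onto its codomain.  This is proved by induction on n, simultaneously with the
-- values of α_n at π_n.  The preimage of σ ∈ E_n is σ ∘ (n a) when its fixed
-- point a is below n; when σ fixes n it is f_n(n, ε) ∘ (n b) if
-- ε = α_{n-1}(σ ∖ n) ∈ E_{n-1} has the fixed point b, and π_n if
-- α_{n-1}(σ ∖ n) = π_{n-1}.

module Submission where

open import Defs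
open import Data.Nat using (ℕ; zero; suc; _≤_; _<_; z≤n; s≤s)
open import Data.Nat.Properties using (<-irrefl; 1+n≢0; n≤1⇒n≡0∨n≡1) renaming (_≟_ to _≟ℕ_)
open import Data.Bool using (Bool; true; false; if_then_else_; not)
open import Data.Bool.Properties using (not-involutive; not-injective)
open import Data.Fin using (Fin; zero; suc; inject₁)
open import Data.Fin.Properties using (fromℕ≢inject₁; inject₁-injective; suc-injective; any?) renaming (_≟_ to _≟F_)
open import Data.Fin.Relation.Unary.Top using (view; ‵fromℕ; ‵inject₁)
open import Data.Fin.Permutation.Components using (transpose; transpose-inverse)
open import Data.Vec using (Vec; []; _∷_; lookup; tabulate)
open import Data.Vec.Properties using (lookup∘tabulate; tabulate∘lookup; tabulate-cong)
open import Data.List using (List; []; _∷_; _++_; map; filter; length; allFin)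
open import Data.List.Properties using (filter-none; filter-some)
open import Data.List.Membership.Propositional using (_∈_)
open import Data.List.Membership.Propositional.Properties
  using (∈-filter⁺; ∈-filter⁻; ∈-allFin; ∈-map⁺; ∈-map⁻; ∈-concatMap⁺; ∈-++⁺ʳ)
open import Data.List.Relation.Unary.Any using (here; there)
import Data.List.Relation.Unary.Any as Any
import Data.List.Relation.Unary.Any.Properties as Anyₚ
open import Data.List.Relation.Unary.All using (_∷_)
import Data.List.Relation.Unary.All.Properties as Allₚ
open import Data.List.Relation.Unary.AllPairs using (_∷_)
open import Data.List.Relation.Unary.Unique.Propositional using (Unique)
import Data.List.Relation.Unary.Unique.Propositional.Properties as Unique
open import Data.Maybe using (just; nothing)
open import Data.Product using (Σ; ∃; _×_; _,_; proj₁; proj₂; uncurry)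
open import Data.Sum using (_⊎_; inj₁; inj₂)
open import Data.Empty using (⊥-elim)
open import Function using (_∘′_)
open import Relation.Binary.PropositionalEquality
open import Relation.Nullary using (¬_; Dec; yes; no; _×-dec_)
open import Relation.Nullary.Decidable using (⌊_⌋; isYes≗does; dec-true; dec-false)
open import Relation.Unary using (Decidable)

infixl 30 _!_
_!_ : ∀ {n} {A : Set} → Vec A n → Fin n → A
v ! i = lookup v i

lookup-ext : ∀ {n} {A : Set} {u v : Vec A n} → (∀ x → u ! x ≡ v ! x) → u ≡ v
lookup-ext {u = u} {v} u≗v =
  trans (sym (tabulate∘lookup u)) (trans (tabulate-cong u≗v) (tabulate∘lookup v))

if-true : ∀ {A : Set} {b : Bool} {x y : A} → b ≡ true → (if b then x else y) ≡ x
if-true refl = refl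

if-false : ∀ {A : Set} {b : Bool} {x y : A} → b ≡ false → (if b then x else y) ≡ y
if-false refl = refl

isYes-true : ∀ {A : Set} (a? : Dec A) → A → ⌊ a? ⌋ ≡ true
isYes-true a? a = trans (isYes≗does a?) (dec-true a? a)

isYes-false : ∀ {A : Set} (a? : Dec A) → ¬ A → ⌊ a? ⌋ ≡ false
isYes-false a? ¬a = trans (isYes≗does a?) (dec-false a? ¬a)

≡⇒== : ∀ {n} {i j : Fin n} → i ≡ j → (i == j) ≡ true
≡⇒== {i = i} {j} = isYes-true (i ≟F j)

≢⇒== : ∀ {n} {i j : Fin n} → i ≢ j → (i == j) ≡ false
≢⇒== {i = i} {j} = isYes-false (i ≟F j)

top⊎inject₁ : ∀ {m} (i : Fin (suc m)) → i ≡ top ⊎ ∃ λ j → i ≡ inject₁ j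
top⊎inject₁ i with view i
... | ‵fromℕ = inj₁ refl
... | ‵inject₁ j = inj₂ (j , refl)

inject₁≢top : ∀ {m} {j : Fin m} → inject₁ j ≢ top
inject₁≢top e = fromℕ≢inject₁ (sym e)

split-top : ∀ {m} → split (top {m}) ≡ nothing
split-top {zero} = refl
split-top {suc m} rewrite split-top {m} = refl

split-inject₁ : ∀ {m} (j : Fin m) → split (inject₁ j) ≡ just j
split-inject₁ {suc m} zero = refl
split-inject₁ {suc m} (suc j) rewrite split-inject₁ j = refl

lowerOr-inject₁ : ∀ {m} (d j : Fin m) → lowerOr d (inject₁ j) ≡ j
lowerOr-inject₁ d j rewrite split-inject₁ j = refl

FixedPointFree : ∀ {n} → Perm n → Set
FixedPointFree σ = ∀ x → σ ! x ≢ x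

UniqueFixedPoint : ∀ {n} → Perm n → Fin n → Set
UniqueFixedPoint σ p = (σ ! p ≡ p) × (∀ y → σ ! y ≡ y → y ≡ p)

module _ {A : Set} {P : A → Set} (P? : Decidable P) where

  filter-length≡1⇒unique : ∀ {x y} xs → length (filter P? xs) ≡ 1 →
                           x ∈ xs → y ∈ xs → P x → P y → x ≡ y
  filter-length≡1⇒unique xs len x∈ y∈ px py =
    singleton (filter P? xs) len (∈-filter⁺ P? x∈ px) (∈-filter⁺ P? y∈ py)
    where
    singleton : ∀ {x y} (L : List A) → length L ≡ 1 → x ∈ L → y ∈ L → x ≡ y
    singleton (_ ∷ []) _ (here refl) (here refl) = refl

  filter-length≤1 : ∀ {z} xs → Unique xs → (∀ x → P x → x ≡ z) → length (filter P? xs) ≤ 1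
  filter-length≤1 {z} xs u onlyZ =
    constant (filter P? xs) (Unique.filter⁺ P? u) (λ x x∈ → onlyZ x (proj₂ (∈-filter⁻ P? {xs = xs} x∈)))
    where
    constant : (L : List A) → Unique L → (∀ x → x ∈ L → x ≡ z) → length L ≤ 1
    constant [] _ _ = z≤n
    constant (_ ∷ []) _ _ = s≤s z≤n
    constant (a ∷ b ∷ _) ((a≢b ∷ _) ∷ _) h = ⊥-elim (a≢b (trans (h a (here refl)) (sym (h b (there (here refl))))))

isFixed? : ∀ {n} (σ : Perm n) → Decidable (λ x → σ ! x ≡ x)
isFixed? σ x = σ ! x ≟F x

fixedPointFree⇒derangement : ∀ {n} (σ : Perm n) → FixedPointFree σ → Derangement σ
fixedPointFree⇒derangement σ free = cong length (filter-none (isFixed? σ) (Allₚ.tabulate⁺ free))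

derangement⇒fixedPointFree : ∀ {n} (σ : Perm n) → Derangement σ → FixedPointFree σ
derangement⇒fixedPointFree σ der x fx =
  <-irrefl refl (subst (0 <_) der (filter-some (isFixed? σ) (Anyₚ.tabulate⁺ x fx)))

fixedPoint : ∀ {n} (σ : Perm n) → ¬ Derangement σ → ∃ λ x → σ ! x ≡ x
fixedPoint σ ¬der with any? (isFixed? σ)
... | yes fx = fx
... | no ¬fx = ⊥-elim (¬der (fixedPointFree⇒derangement σ λ x fx → ¬fx (x , fx)))

uniqueFixedPoint : ∀ {n} (σ : Perm n) → OneFixed σ → ∃ (UniqueFixedPoint σ)
uniqueFixedPoint {n} σ one with fixedPoint σ (λ der → 1+n≢0 (trans (sym one) der))
... | p , fp = p , fp , λ y fy →
  filter-length≡1⇒unique (isFixed? σ) (allFin n) one (∈-allFin y) (∈-allFin p) fy fp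

fixedPoint-below-top : ∀ {m} (σ : Perm (suc m)) → ¬ Derangement σ → ¬ OneFixed σ →
                       ∃ λ x → σ ! inject₁ x ≡ inject₁ x
fixedPoint-below-top {m} σ ¬der ¬one with any? (λ x → σ ! inject₁ x ≟F inject₁ x)
... | yes fx = fx
... | no ¬fx with n≤1⇒n≡0∨n≡1 (filter-length≤1 (isFixed? σ) (allFin (suc m)) (Unique.allFin⁺ (suc m)) onlyTop)
  where
  onlyTop : ∀ x → σ ! x ≡ x → x ≡ top
  onlyTop x fx with top⊎inject₁ x
  ... | inj₁ x≡top = x≡top
  ... | inj₂ (j , refl) = ⊥-elim (¬fx (j , fx))
... | inj₁ none = ⊥-elim (¬der none)
... | inj₂ one = ⊥-elim (¬one one)

-- Deleting n from a permutation and the map f_n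

delTop-direct : ∀ {m} (σ : Perm (suc m)) {x y : Fin m} →
                σ ! inject₁ x ≡ inject₁ y → delTop σ ! x ≡ y
delTop-direct σ {x} {y} e = begin
  delTop σ ! x
    ≡⟨ lookup∘tabulate _ x ⟩
  (if σ ! inject₁ x == top then lowerOr x (σ ! top) else lowerOr x (σ ! inject₁ x))
    ≡⟨ cong (λ v → if v == top then lowerOr x (σ ! top) else lowerOr x v) e ⟩
  (if inject₁ y == top then lowerOr x (σ ! top) else lowerOr x (inject₁ y))
    ≡⟨ if-false (≢⇒== (inject₁≢top {j = y})) ⟩
  lowerOr x (inject₁ y)
    ≡⟨ lowerOr-inject₁ x y ⟩
  y ∎
  where open ≡-Reasoning

delTop-bypass : ∀ {m} (σ : Perm (suc m)) {x y : Fin m} →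
                σ ! inject₁ x ≡ top → σ ! top ≡ inject₁ y → delTop σ ! x ≡ y
delTop-bypass {m} σ {x} {y} e e′ = begin
  delTop σ ! x
    ≡⟨ lookup∘tabulate _ x ⟩
  (if σ ! inject₁ x == top then lowerOr x (σ ! top) else lowerOr x (σ ! inject₁ x))
    ≡⟨ cong (λ v → if v == top then lowerOr x (σ ! top) else lowerOr x v) e ⟩
  (if top == top then lowerOr x (σ ! top) else lowerOr x top)
    ≡⟨ if-true (≡⇒== {i = top {m}} refl) ⟩
  lowerOr x (σ ! top)
    ≡⟨ cong (lowerOr x) e′ ⟩
  lowerOr x (inject₁ y)
    ≡⟨ lowerOr-inject₁ x y ⟩
  y ∎
  where open ≡-Reasoning

delTop-spec : ∀ {m} (σ : Perm (suc m)) → IsPerm σ → ∀ j →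
  ((σ ! inject₁ j ≡ top) × (σ ! top ≡ inject₁ (delTop σ ! j))) ⊎
  ((σ ! inject₁ j ≡ inject₁ (delTop σ ! j)) × (σ ! top ≢ inject₁ (delTop σ ! j)))
delTop-spec σ σ-perm j with top⊎inject₁ (σ ! inject₁ j)
... | inj₁ e with top⊎inject₁ (σ ! top)
...   | inj₁ e′ = ⊥-elim (inject₁≢top (σ-perm _ _ (trans e (sym e′))))
...   | inj₂ (y , e′) = inj₁ (e , trans e′ (cong inject₁ (sym (delTop-bypass σ e e′))))
delTop-spec σ σ-perm j | inj₂ (y , e) =
  inj₂ (trans e (cong inject₁ (sym (delTop-direct σ e))) ,
        λ e′ → inject₁≢top (sym (σ-perm _ _ (trans e′ (trans (cong inject₁ (delTop-direct σ e)) (sym e))))))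

delTop-isPerm : ∀ {m} (σ : Perm (suc m)) → IsPerm σ → IsPerm (delTop σ)
delTop-isPerm σ σ-perm x y e with delTop-spec σ σ-perm x | delTop-spec σ σ-perm y
... | inj₁ (a , _) | inj₁ (b , _) = inject₁-injective (σ-perm _ _ (trans a (sym b)))
... | inj₁ (_ , b) | inj₂ (_ , d) = ⊥-elim (d (trans b (cong inject₁ e)))
... | inj₂ (_ , d) | inj₁ (_ , b) = ⊥-elim (d (trans b (cong inject₁ (sym e))))
... | inj₂ (a , _) | inj₂ (b , _) = inject₁-injective (σ-perm _ _ (trans a (trans (cong inject₁ e) (sym b))))

H-injective : ∀ {m} (σ τ : Perm (suc m)) → IsPerm σ → IsPerm τ → H σ ≡ H τ → σ ≡ τ
H-injective σ τ σ-perm τ-perm Hσ≡Hτ = lookup-ext pointwise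
  where
  top≡ : σ ! top ≡ τ ! top
  top≡ = cong proj₁ Hσ≡Hτ
  below≡ : ∀ j → inject₁ (delTop σ ! j) ≡ inject₁ (delTop τ ! j)
  below≡ j = cong (λ δ → inject₁ (δ ! j)) (cong proj₂ Hσ≡Hτ)
  pointwise : ∀ x → σ ! x ≡ τ ! x
  pointwise x with top⊎inject₁ x
  ... | inj₁ refl = top≡
  ... | inj₂ (j , refl) with delTop-spec σ σ-perm j | delTop-spec τ τ-perm j
  ...   | inj₁ (a , _) | inj₁ (b , _) = trans a (sym b)
  ...   | inj₁ (_ , b) | inj₂ (_ , d) = ⊥-elim (d (trans (sym top≡) (trans b (below≡ j))))
  ...   | inj₂ (_ , d) | inj₁ (_ , b) = ⊥-elim (d (trans top≡ (trans b (sym (below≡ j)))))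
  ...   | inj₂ (a , _) | inj₂ (b , _) = trans a (trans (below≡ j) (sym b))

f-top-top : ∀ {m} (ρ : Perm m) → f (top , ρ) ! top ≡ top
f-top-top {m} ρ rewrite lookup∘tabulate (fF top ρ) top | split-top {m} | split-top {m} = refl

f-top-inject₁ : ∀ {m} (ρ : Perm m) x → f (top , ρ) ! inject₁ x ≡ inject₁ (ρ ! x)
f-top-inject₁ {m} ρ x rewrite lookup∘tabulate (fF top ρ) (inject₁ x) | split-top {m} | split-inject₁ x = refl

f-inject₁-top : ∀ {m} (ρ : Perm m) a → f (inject₁ a , ρ) ! top ≡ inject₁ (ρ ! a)
f-inject₁-top {m} ρ a rewrite lookup∘tabulate (fF (inject₁ a) ρ) top | split-inject₁ a | split-top {m} = refl

f-inject₁-self : ∀ {m} (ρ : Perm m) a → f (inject₁ a , ρ) ! inject₁ a ≡ inject₁ a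
f-inject₁-self ρ a rewrite lookup∘tabulate (fF (inject₁ a) ρ) (inject₁ a) | split-inject₁ a | split-inject₁ a =
  if-true (≡⇒== {i = a} refl)

f-inject₁-pre : ∀ {m} (ρ : Perm m) a x → x ≢ a → ρ ! x ≡ a → f (inject₁ a , ρ) ! inject₁ x ≡ top
f-inject₁-pre ρ a x x≢a ρx≡a rewrite lookup∘tabulate (fF (inject₁ a) ρ) (inject₁ x) | split-inject₁ a | split-inject₁ x =
  trans (if-false (≢⇒== x≢a))
        (trans (cong (λ v → if v == a then top else inject₁ v) ρx≡a) (if-true (≡⇒== {i = a} refl)))

f-inject₁-other : ∀ {m} (ρ : Perm m) a x → x ≢ a → ρ ! x ≢ a → f (inject₁ a , ρ) ! inject₁ x ≡ inject₁ (ρ ! x)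
f-inject₁-other ρ a x x≢a ρx≢a rewrite lookup∘tabulate (fF (inject₁ a) ρ) (inject₁ x) | split-inject₁ a | split-inject₁ x =
  trans (if-false (≢⇒== x≢a)) (if-false (≢⇒== ρx≢a))

data FView {m} (ρ : Perm m) (a : Fin m) : Fin (suc m) → Fin (suc m) → Set where
  at-top   : FView ρ a top (inject₁ (ρ ! a))
  at-self  : FView ρ a (inject₁ a) (inject₁ a)
  at-pre   : ∀ x → x ≢ a → ρ ! x ≡ a → FView ρ a (inject₁ x) top
  at-other : ∀ x → x ≢ a → ρ ! x ≢ a → FView ρ a (inject₁ x) (inject₁ (ρ ! x))

f-view : ∀ {m} (ρ : Perm m) a y → FView ρ a y (f (inject₁ a , ρ) ! y)
f-view ρ a y with top⊎inject₁ y
... | inj₁ refl rewrite f-inject₁-top ρ a = at-top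
... | inj₂ (x , refl) with x ≟F a
...   | yes refl rewrite f-inject₁-self ρ x = at-self
...   | no x≢a with ρ ! x ≟F a
...     | yes e rewrite f-inject₁-pre ρ a x x≢a e = at-pre x x≢a e
...     | no ne rewrite f-inject₁-other ρ a x x≢a ne = at-other x x≢a ne

f-top-isPerm : ∀ {m} (ρ : Perm m) → IsPerm ρ → IsPerm (f (top , ρ))
f-top-isPerm ρ ρ-perm x y e with top⊎inject₁ x | top⊎inject₁ y
... | inj₁ refl | inj₁ refl = refl
... | inj₁ refl | inj₂ (j , refl) = ⊥-elim (fromℕ≢inject₁ (trans (sym (f-top-top ρ)) (trans e (f-top-inject₁ ρ j))))
... | inj₂ (i , refl) | inj₁ refl = ⊥-elim (fromℕ≢inject₁ (trans (sym (f-top-top ρ)) (trans (sym e) (f-top-inject₁ ρ i))))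
... | inj₂ (i , refl) | inj₂ (j , refl) =
  cong inject₁ (ρ-perm i j (inject₁-injective (trans (sym (f-top-inject₁ ρ i)) (trans e (f-top-inject₁ ρ j)))))

f-inject₁-isPerm : ∀ {m} (ρ : Perm m) a → IsPerm ρ → FixedPointFree ρ → IsPerm (f (inject₁ a , ρ))
f-inject₁-isPerm ρ a ρ-perm free x y e = go (f-view ρ a x) (f-view ρ a y) e
  where
  go : ∀ {x y vx vy} → FView ρ a x vx → FView ρ a y vy → vx ≡ vy → x ≡ y
  go at-top at-top _ = refl
  go at-top at-self e = ⊥-elim (free a (inject₁-injective e))
  go at-top (at-pre _ _ _) e = ⊥-elim (inject₁≢top e)
  go at-top (at-other _ x≢a _) e = ⊥-elim (x≢a (sym (ρ-perm _ _ (inject₁-injective e))))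
  go at-self at-top e = ⊥-elim (free a (inject₁-injective (sym e)))
  go at-self at-self _ = refl
  go at-self (at-pre _ _ _) e = ⊥-elim (inject₁≢top e)
  go at-self (at-other _ _ ρx≢a) e = ⊥-elim (ρx≢a (sym (inject₁-injective e)))
  go (at-pre _ _ _) at-top e = ⊥-elim (inject₁≢top (sym e))
  go (at-pre _ _ _) at-self e = ⊥-elim (inject₁≢top (sym e))
  go (at-pre _ _ e₁) (at-pre _ _ e₂) _ = cong inject₁ (ρ-perm _ _ (trans e₁ (sym e₂)))
  go (at-pre _ _ _) (at-other _ _ _) e = ⊥-elim (inject₁≢top (sym e))
  go (at-other _ x≢a _) at-top e = ⊥-elim (x≢a (ρ-perm _ _ (inject₁-injective e)))
  go (at-other _ _ ρx≢a) at-self e = ⊥-elim (ρx≢a (inject₁-injective e))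
  go (at-other _ _ _) (at-pre _ _ _) e = ⊥-elim (inject₁≢top e)
  go (at-other _ _ _) (at-other _ _ _) e = cong inject₁ (ρ-perm _ _ (inject₁-injective e))

delTop-fixedPointFree : ∀ {m} (τ : Perm (suc m)) → IsPerm τ → FixedPointFree τ →
                        τ ! (τ ! top) ≢ top → FixedPointFree (delTop τ)
delTop-fixedPointFree τ τ-perm free long x e with delTop-spec τ τ-perm x
... | inj₁ (a , b) = long (trans (cong (τ !_) (trans b (cong inject₁ e))) a)
... | inj₂ (a , _) = free (inject₁ x) (trans a (cong inject₁ e))

delTop-uniqueFixedPoint : ∀ {m} (τ : Perm (suc m)) → IsPerm τ → FixedPointFree τ → ∀ a →
                          τ ! top ≡ inject₁ a → τ ! inject₁ a ≡ top → UniqueFixedPoint (delTop τ) a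
delTop-uniqueFixedPoint τ τ-perm free a e₁ e₂ = delTop-bypass τ e₂ e₁ , unique
  where
  unique : ∀ y → delTop τ ! y ≡ y → y ≡ a
  unique y e with delTop-spec τ τ-perm y
  ... | inj₁ (_ , b) = inject₁-injective (trans (sym (trans b (cong inject₁ e))) e₁)
  ... | inj₂ (b , _) = ⊥-elim (free (inject₁ y) (trans b (cong inject₁ e)))

delTop-fixedPointFree-topFixed : ∀ {m} (σ : Perm (suc m)) → IsPerm σ → UniqueFixedPoint σ top →
                         FixedPointFree (delTop σ)
delTop-fixedPointFree-topFixed σ σ-perm (fixed , unique) x e with delTop-spec σ σ-perm x
... | inj₁ (a , _) = inject₁≢top (σ-perm _ _ (trans a (sym fixed)))
... | inj₂ (a , _) = inject₁≢top (unique (inject₁ x) (trans a (cong inject₁ e)))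

f-top-uniqueFixedPoint : ∀ {m} (ρ : Perm m) → FixedPointFree ρ → UniqueFixedPoint (f (top , ρ)) top
f-top-uniqueFixedPoint ρ free = f-top-top ρ , unique
  where
  unique : ∀ y → f (top , ρ) ! y ≡ y → y ≡ top
  unique y e with top⊎inject₁ y
  ... | inj₁ y≡top = y≡top
  ... | inj₂ (j , refl) = ⊥-elim (free j (inject₁-injective (trans (sym (f-top-inject₁ ρ j)) e)))

f-inject₁-uniqueFixedPoint : ∀ {m} (ρ : Perm m) a → FixedPointFree ρ →
                             UniqueFixedPoint (f (inject₁ a , ρ)) (inject₁ a)
f-inject₁-uniqueFixedPoint ρ a free = f-inject₁-self ρ a , λ y e → unique (f-view ρ a y) e
  where
  unique : ∀ {y v} → FView ρ a y v → v ≡ y → y ≡ inject₁ a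
  unique at-top e = ⊥-elim (inject₁≢top e)
  unique at-self _ = refl
  unique (at-pre _ _ _) e = ⊥-elim (inject₁≢top (sym e))
  unique (at-other x _ _) e = ⊥-elim (free x (inject₁-injective e))

delTop∘f-top : ∀ {m} (ρ : Perm m) → delTop (f (top , ρ)) ≡ ρ
delTop∘f-top ρ = lookup-ext λ x → delTop-direct (f (top , ρ)) (f-top-inject₁ ρ x)

f-top∘delTop : ∀ {m} (σ : Perm (suc m)) → IsPerm σ → σ ! top ≡ top → f (top , delTop σ) ≡ σ
f-top∘delTop σ σ-perm fixed = lookup-ext pointwise
  where
  pointwise : ∀ x → f (top , delTop σ) ! x ≡ σ ! x
  pointwise x with top⊎inject₁ x
  ... | inj₁ refl = trans (f-top-top (delTop σ)) (sym fixed)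
  ... | inj₂ (j , refl) with delTop-spec σ σ-perm j
  ...   | inj₁ (a , _) = ⊥-elim (inject₁≢top (σ-perm _ _ (trans a (sym fixed))))
  ...   | inj₂ (a , _) = trans (f-top-inject₁ (delTop σ) j) (sym a)

f-top-injective : ∀ {m} (ρ₁ ρ₂ : Perm m) → f (top , ρ₁) ≡ f (top , ρ₂) → ρ₁ ≡ ρ₂
f-top-injective ρ₁ ρ₂ e = trans (sym (delTop∘f-top ρ₁)) (trans (cong delTop e) (delTop∘f-top ρ₂))

f-inject₁≢f-top : ∀ {m} (ρ₁ ρ₂ : Perm m) a → f (inject₁ a , ρ₁) ≢ f (top , ρ₂)
f-inject₁≢f-top ρ₁ ρ₂ a e =
  inject₁≢top (trans (sym (f-inject₁-top ρ₁ a)) (trans (cong (_! top) e) (f-top-top ρ₂)))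

f-inject₁-injective : ∀ {m} (ρ₁ ρ₂ : Perm m) a₁ a₂ → FixedPointFree ρ₁ → FixedPointFree ρ₂ →
                      f (inject₁ a₁ , ρ₁) ≡ f (inject₁ a₂ , ρ₂) → (a₁ ≡ a₂) × (ρ₁ ≡ ρ₂)
f-inject₁-injective ρ₁ ρ₂ a a₂ free₁ free₂ e
  with inject₁-injective (proj₂ (f-inject₁-uniqueFixedPoint ρ₂ a₂ free₂) (inject₁ a)
                           (trans (cong (_! inject₁ a) (sym e)) (f-inject₁-self ρ₁ a)))
... | refl = refl , lookup-ext pointwise
  where
  F≡ : ∀ y → f (inject₁ a , ρ₁) ! y ≡ f (inject₁ a , ρ₂) ! y
  F≡ y = cong (_! y) e
  pointwise : ∀ x → ρ₁ ! x ≡ ρ₂ ! x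
  pointwise x with x ≟F a
  ... | yes refl = inject₁-injective (trans (sym (f-inject₁-top ρ₁ x)) (trans (F≡ top) (f-inject₁-top ρ₂ x)))
  ... | no x≢a with ρ₁ ! x ≟F a | ρ₂ ! x ≟F a
  ...   | yes e₁ | yes e₂ = trans e₁ (sym e₂)
  ...   | yes e₁ | no n₂ = ⊥-elim (fromℕ≢inject₁ (trans (sym (f-inject₁-pre ρ₁ a x x≢a e₁))
                            (trans (F≡ (inject₁ x)) (f-inject₁-other ρ₂ a x x≢a n₂))))
  ...   | no n₁ | yes e₂ = ⊥-elim (fromℕ≢inject₁ (trans (sym (f-inject₁-pre ρ₂ a x x≢a e₂))
                            (trans (sym (F≡ (inject₁ x))) (f-inject₁-other ρ₁ a x x≢a n₁))))
  ...   | no n₁ | no n₂ = inject₁-injective (trans (sym (f-inject₁-other ρ₁ a x x≢a n₁))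
                            (trans (F≡ (inject₁ x)) (f-inject₁-other ρ₂ a x x≢a n₂)))

delTop-f-inject₁-fixed : ∀ {m} (ρ : Perm m) a → delTop (f (inject₁ a , ρ)) ! a ≡ a
delTop-f-inject₁-fixed ρ a = delTop-direct (f (inject₁ a , ρ)) (f-inject₁-self ρ a)

ζρ-def : ∀ {m} (σ : Perm (suc m)) (x : Fin m) → ζρ σ ! x ≡
  (if σ ! inject₁ x == top then lowerOr x (σ ! (σ ! top))
   else (if inject₁ x == σ ! top then x else lowerOr x (σ ! inject₁ x)))
ζρ-def σ x = lookup∘tabulate _ x

H-f-longCycle : ∀ {m} (τ : Perm (suc m)) → IsPerm τ → ∀ a →
                τ ! top ≡ inject₁ a → τ ! inject₁ a ≢ top →
                H (f (inject₁ a , delTop τ)) ≡ (τ ! (τ ! top) , ζρ τ)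
H-f-longCycle τ τ-perm a τn≡a τa≢n = cong₂ _,_ σn≡ττn (lookup-ext pointwise)
  where
  ρ = delTop τ
  σ = f (inject₁ a , ρ)

  τa≡ρa : τ ! inject₁ a ≡ inject₁ (ρ ! a)
  τa≡ρa with delTop-spec τ τ-perm a
  ... | inj₁ (e , _) = ⊥-elim (τa≢n e)
  ... | inj₂ (e , _) = e

  σn≡ττn : σ ! top ≡ τ ! (τ ! top)
  σn≡ττn = trans (f-inject₁-top ρ a) (trans (sym τa≡ρa) (cong (τ !_) (sym τn≡a)))

  pointwise : ∀ x → delTop σ ! x ≡ ζρ τ ! x
  pointwise x with x ≟F a
  ... | yes refl = trans (delTop-f-inject₁-fixed ρ x)
                     (sym (trans (ζρ-def τ x) (trans (if-false (≢⇒== τa≢n)) (if-true (≡⇒== (sym τn≡a))))))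
  ... | no x≢a with ρ ! x ≟F a
  ...   | yes ρx≡a with delTop-spec τ τ-perm x
  ...     | inj₂ (b , _) = ⊥-elim (inject₁≢top (τ-perm _ _ (trans b (trans (cong inject₁ ρx≡a) (sym τn≡a)))))
  ...     | inj₁ (b , _) = trans (delTop-bypass σ (f-inject₁-pre ρ a x x≢a ρx≡a) (f-inject₁-top ρ a))
                (sym (trans (ζρ-def τ x) (trans (if-true (≡⇒== b))
                  (trans (cong (lowerOr x) (trans (cong (τ !_) τn≡a) τa≡ρa)) (lowerOr-inject₁ x (ρ ! a))))))
  pointwise x | no x≢a | no ρx≢a with delTop-spec τ τ-perm x
  ...     | inj₁ (_ , b) = ⊥-elim (ρx≢a (inject₁-injective (trans (sym b) τn≡a)))
  ...     | inj₂ (b , _) = trans (delTop-direct σ (f-inject₁-other ρ a x x≢a ρx≢a))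
                (sym (trans (ζρ-def τ x) (trans (if-false (≢⇒== (λ q → inject₁≢top (trans (sym b) q))))
                  (trans (if-false (≢⇒== (λ q → x≢a (inject₁-injective (trans q τn≡a)))))
                    (trans (cong (lowerOr x) b) (lowerOr-inject₁ x (ρ ! x)))))))

-- The permutations π_n

odd-suc-suc : ∀ k → odd (suc (suc k)) ≡ odd k
odd-suc-suc k = not-involutive (odd k)

piF-involutive : ∀ n (x : Fin n) → piF n (piF n x) ≡ x
piF-involutive (suc zero) zero = refl
piF-involutive (suc (suc n)) zero = refl
piF-involutive (suc (suc n)) (suc zero) = refl
piF-involutive (suc (suc n)) (suc (suc i)) = cong (λ v → suc (suc v)) (piF-involutive n i)

piF-fixedPointFree : ∀ n → odd n ≡ false → ∀ (x : Fin n) → piF n x ≢ x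
piF-fixedPointFree (suc zero) () x
piF-fixedPointFree (suc (suc n)) even (suc (suc i)) e =
  piF-fixedPointFree n (trans (sym (odd-suc-suc n)) even) i (suc-injective (suc-injective e))

piF-even : ∀ n → odd n ≡ false →
           (∀ x → piF (suc n) (inject₁ x) ≡ inject₁ (piF n x)) × (piF (suc n) top ≡ top)
piF-even zero _ = (λ ()) , refl
piF-even (suc zero) ()
piF-even (suc (suc k)) even with piF-even k (trans (sym (odd-suc-suc k)) even)
... | below , top-fixed = below′ , cong (λ v → suc (suc v)) top-fixed
  where
  below′ : ∀ x → piF (suc (suc (suc k))) (inject₁ x) ≡ inject₁ (piF (suc (suc k)) x)
  below′ zero = refl
  below′ (suc zero) = refl
  below′ (suc (suc i)) = cong (λ v → suc (suc v)) (below i)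

piF-odd : ∀ q → odd (suc q) ≡ true →
  (piF (suc (suc q)) top ≡ inject₁ top) × (piF (suc (suc q)) (inject₁ top) ≡ top) ×
  (∀ x → x ≢ top → piF (suc (suc q)) (inject₁ x) ≡ inject₁ (piF (suc q) x)) × (piF (suc q) top ≡ top)
piF-odd zero _ = refl , refl , (λ { zero x≢top → ⊥-elim (x≢top refl) }) , refl
piF-odd (suc zero) ()
piF-odd (suc (suc k)) odd′ with piF-odd k (trans (sym (odd-suc-suc (suc k))) odd′)
... | i₁ , i₂ , below , i₄ =
  cong (λ v → suc (suc v)) i₁ , cong (λ v → suc (suc v)) i₂ , below′ , cong (λ v → suc (suc v)) i₄
  where
  below′ : ∀ x → x ≢ top → piF (suc (suc (suc (suc k)))) (inject₁ x) ≡ inject₁ (piF (suc (suc (suc k))) x)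
  below′ zero _ = refl
  below′ (suc zero) _ = refl
  below′ (suc (suc i)) x≢top = cong (λ v → suc (suc v)) (below i (λ e → x≢top (cong (λ v → suc (suc v)) e)))

π-lookup : ∀ n x → π n ! x ≡ piF n x
π-lookup n x = lookup∘tabulate (piF n) x

π-isPerm : ∀ n → IsPerm (π n)
π-isPerm n x y e = begin
  x                     ≡⟨ sym (piF-involutive n x) ⟩
  piF n (piF n x)       ≡⟨ cong (piF n) (trans (sym (π-lookup n x)) (trans e (π-lookup n y))) ⟩
  piF n (piF n y)       ≡⟨ piF-involutive n y ⟩
  y                     ∎
  where open ≡-Reasoning

π-fixedPointFree : ∀ n → odd n ≡ false → FixedPointFree (π n)
π-fixedPointFree n even x e = piF-fixedPointFree n even x (trans (sym (π-lookup n x)) e)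

f-top-π : ∀ n → odd n ≡ false → f (top , π n) ≡ π (suc n)
f-top-π n even = lookup-ext pointwise
  where
  pointwise : ∀ x → f (top , π n) ! x ≡ π (suc n) ! x
  pointwise x with top⊎inject₁ x
  ... | inj₁ refl = trans (f-top-top (π n)) (sym (trans (π-lookup (suc n) top) (proj₂ (piF-even n even))))
  ... | inj₂ (j , refl) = trans (f-top-inject₁ (π n) j) (trans (cong inject₁ (π-lookup n j))
        (sym (trans (π-lookup (suc n) (inject₁ j)) (proj₁ (piF-even n even) j))))

π-top-2-cycle : ∀ q → odd (suc q) ≡ true → π (suc (suc q)) ! (π (suc (suc q)) ! top) ≡ top
π-top-2-cycle q odd′ with piF-odd q odd′
... | i₁ , i₂ , _ = trans (cong (π (suc (suc q)) !_) (trans (π-lookup (suc (suc q)) top) i₁))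
                          (trans (π-lookup (suc (suc q)) _) i₂)

delTop-π : ∀ q → odd (suc q) ≡ true → delTop (π (suc (suc q))) ≡ π (suc q)
delTop-π q odd′ with piF-odd q odd′
... | i₁ , i₂ , below , i₄ = lookup-ext pointwise
  where
  pointwise : ∀ x → delTop (π (suc (suc q))) ! x ≡ π (suc q) ! x
  pointwise x with x ≟F top
  ... | yes refl = trans (delTop-bypass (π (suc (suc q))) {x = top} {y = top} (trans (π-lookup (suc (suc q)) _) i₂)
                                                         (trans (π-lookup (suc (suc q)) top) i₁))
                         (sym (trans (π-lookup (suc q) top) i₄))
  ... | no x≢top = trans (delTop-direct (π (suc (suc q))) {x = x} {y = piF (suc q) x} (trans (π-lookup (suc (suc q)) _) (below x x≢top)))
                         (sym (π-lookup (suc q) x))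

∈-allVecs : ∀ n k (v : Vec (Fin n) k) → v ∈ allVecs n k
∈-allVecs n zero [] = here refl
∈-allVecs n (suc k) (a ∷ v) =
  ∈-concatMap⁺ (λ w → map (_∷ w) (allFin n))
    (Any.map (λ { refl → ∈-map⁺ (_∷ v) (∈-allFin a) }) (∈-allVecs n k v))

isDerangement? : ∀ {n} (σ : Perm n) → Dec (IsPerm σ × Derangement σ)
isDerangement? σ = isPerm? σ ×-dec (nfix σ ≟ℕ 0)

∈-allDer⁺ : ∀ {n} {τ : Perm n} → IsPerm τ → FixedPointFree τ → τ ∈ allDer n
∈-allDer⁺ {n} {τ} τ-perm free =
  ∈-filter⁺ isDerangement? (∈-allVecs n n τ) (τ-perm , fixedPointFree⇒derangement τ free)

∈-allDer⁻ : ∀ {n} {τ : Perm n} → τ ∈ allDer n → IsPerm τ × FixedPointFree τ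
∈-allDer⁻ {n} {τ} τ∈ with ∈-filter⁻ isDerangement? {xs = allVecs n n} τ∈
... | _ , τ-perm , der = τ-perm , derangement⇒fixedPointFree τ der

invBy-sound : ∀ {n} (g : PX n → PX n) cs t {c₀} → c₀ ∈ cs → g c₀ ≡ t →
              (invBy g cs t ∈ cs) × (g (invBy g cs t) ≡ t)
invBy-sound g (c ∷ cs) t c₀∈ e with g c ≟X t
... | yes gc≡t = here refl , gc≡t
... | no gc≢t with c₀∈
...   | here refl = ⊥-elim (gc≢t e)
...   | there c₀∈cs with invBy-sound g cs t c₀∈cs e
...     | ∈cs , found = there ∈cs , found

invBy-unique : ∀ {n} (g : PX n → PX n) cs t {c₀} →
               (∀ {c c′} → c ∈ cs → c′ ∈ cs → g c ≡ g c′ → c ≡ c′) →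
               c₀ ∈ cs → g c₀ ≡ t → invBy g cs t ≡ c₀
invBy-unique g cs t injective c₀∈ e with invBy-sound g cs t c₀∈ e
... | ∈cs , found = injective ∈cs c₀∈ (trans found (sym e))

∈-domα⁻ : ∀ {n c} → c ∈ domα n → (c ≡ pi × odd n ≡ true) ⊎ ∃ λ τ → c ≡ perm τ × τ ∈ allDer n
∈-domα⁻ {n} = split-domain (odd n)
  where
  split-domain : ∀ {c} b → c ∈ (if b then pi ∷ [] else []) ++ map perm (allDer n) →
                 (c ≡ pi × b ≡ true) ⊎ ∃ λ τ → c ≡ perm τ × τ ∈ allDer n
  split-domain true (here refl) = inj₁ (refl , refl)
  split-domain true (there c∈) with ∈-map⁻ perm c∈
  ... | τ , τ∈ , e = inj₂ (τ , e , τ∈)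
  split-domain false c∈ with ∈-map⁻ perm c∈
  ... | τ , τ∈ , e = inj₂ (τ , e , τ∈)

perm∈domα : ∀ {n τ} → τ ∈ allDer n → perm τ ∈ domα n
perm∈domα {n} τ∈ = ∈-++⁺ʳ (if odd n then pi ∷ [] else []) (∈-map⁺ perm τ∈)

pi∈domα : ∀ {n} → odd n ≡ true → pi ∈ domα n
pi∈domα {n} = pi-in (odd n)
  where
  pi-in : ∀ b → b ≡ true → pi ∈ (if b then pi ∷ [] else []) ++ map perm (allDer n)
  pi-in true refl = here refl

perm-injective : ∀ {n} {σ τ : Perm n} → perm σ ≡ perm τ → σ ≡ τ
perm-injective refl = refl

perm≢pi : ∀ {n} {σ : Perm n} → perm σ ≢ pi
perm≢pi ()

α-longCycle : ∀ {k} (τ : Perm (suc (suc k))) → τ ! (τ ! top) ≢ top →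
              α (suc (suc k)) (perm τ) ≡ perm (f (τ ! top , delTop τ))
α-longCycle τ long = if-false (≢⇒== long)

α-2-cycle : ∀ {k} (τ : Perm (suc (suc k))) ρ → τ ! (τ ! top) ≡ top →
            αInv (suc k) (perm (delTop τ)) ≡ perm ρ → α (suc (suc k)) (perm τ) ≡ perm (f (top , ρ))
α-2-cycle τ ρ two e with lookup τ (lookup τ top) ≟F top
... | yes _ rewrite e = refl
... | no ¬two = ⊥-elim (¬two two)

α-2-cycle-π : ∀ {k} (τ : Perm (suc (suc k))) → τ ! (τ ! top) ≡ top →
              αInv (suc k) (perm (delTop τ)) ≡ pi → α (suc (suc k)) (perm τ) ≡ pi
α-2-cycle-π τ two e with lookup τ (lookup τ top) ≟F top
... | yes _ rewrite e = refl
... | no ¬two = ⊥-elim (¬two two)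

α-π : ∀ {k} ρ → odd (suc (suc k)) ≡ true → αInv (suc k) pi ≡ perm ρ →
      α (suc (suc k)) pi ≡ perm (f (top , ρ))
α-π {k} ρ odd′ e with odd (suc (suc k))
... | true rewrite e = refl

-- α_n is a bijection

data Position {m} (p : Fin (suc m)) : Fin (suc m) → Set where
  is-top   : Position p top
  is-p     : Position p p
  is-other : ∀ {x} → x ≢ top → x ≢ p → Position p x

position : ∀ {m} (p x : Fin (suc m)) → Position p x
position p x with x ≟F top | x ≟F p
... | yes refl | _ = is-top
... | no _ | yes refl = is-p
... | no x≢top | no x≢p = is-other x≢top x≢p

transpose-left : ∀ {n} (i j : Fin n) → transpose i j i ≡ j
transpose-left i j rewrite dec-true (i ≟F i) refl = refl

transpose-right : ∀ {n} {i j : Fin n} → j ≢ i → transpose i j j ≡ i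
transpose-right {i = i} {j} j≢i rewrite dec-false (j ≟F i) j≢i | dec-true (j ≟F j) refl = refl

transpose-other : ∀ {n} {i j k : Fin n} → k ≢ i → k ≢ j → transpose i j k ≡ k
transpose-other {i = i} {j} {k} k≢i k≢j rewrite dec-false (k ≟F i) k≢i | dec-false (k ≟F j) k≢j = refl

swapTop : ∀ {m} → Perm (suc m) → Fin (suc m) → Perm (suc m)
swapTop σ p = tabulate (λ x → σ ! transpose top p x)

module _ {m} (σ : Perm (suc m)) (p : Fin (suc m)) where

  private
    entry : ∀ x → swapTop σ p ! x ≡ σ ! transpose top p x
    entry = lookup∘tabulate (λ x → σ ! transpose top p x)

  swapTop-top : swapTop σ p ! top ≡ σ ! p
  swapTop-top = trans (entry top) (cong (σ !_) (transpose-left top p))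

  swapTop-p : p ≢ top → swapTop σ p ! p ≡ σ ! top
  swapTop-p p≢top = trans (entry p) (cong (σ !_) (transpose-right p≢top))

  swapTop-other : ∀ {x} → x ≢ top → x ≢ p → swapTop σ p ! x ≡ σ ! x
  swapTop-other {x} x≢top x≢p = trans (entry x) (cong (σ !_) (transpose-other x≢top x≢p))

  swapTop-isPerm : IsPerm σ → IsPerm (swapTop σ p)
  swapTop-isPerm σ-perm x y e = begin
    x                                      ≡⟨ sym (transpose-inverse p top) ⟩
    transpose p top (transpose top p x)    ≡⟨ cong (transpose p top) (σ-perm _ _ σtx≡σty) ⟩
    transpose p top (transpose top p y)    ≡⟨ transpose-inverse p top ⟩
    y                                      ∎
    where
    open ≡-Reasoning
    σtx≡σty : σ ! transpose top p x ≡ σ ! transpose top p y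
    σtx≡σty = trans (sym (entry x)) (trans e (entry y))

module LongCyclePreimage {k} (σ : Perm (suc (suc k))) (σ-perm : IsPerm σ) (a : Fin (suc k))
                         (unique : UniqueFixedPoint σ (inject₁ a)) where

  τ : Perm (suc (suc k))
  τ = swapTop σ (inject₁ a)

  private
    σa≡a : σ ! inject₁ a ≡ inject₁ a
    σa≡a = proj₁ unique

    σn≢n : σ ! top ≢ top
    σn≢n e = inject₁≢top (sym (proj₂ unique top e))

    τn≡a : τ ! top ≡ inject₁ a
    τn≡a = trans (swapTop-top σ (inject₁ a)) σa≡a

    τa≡σn : τ ! inject₁ a ≡ σ ! top
    τa≡σn = swapTop-p σ (inject₁ a) inject₁≢top

    τ≡σ : ∀ {x} → x ≢ top → x ≢ inject₁ a → τ ! x ≡ σ ! x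
    τ≡σ = swapTop-other σ (inject₁ a)

  τ-isPerm : IsPerm τ
  τ-isPerm = swapTop-isPerm σ (inject₁ a) σ-perm

  τ-fixedPointFree : FixedPointFree τ
  τ-fixedPointFree x e with position (inject₁ a) x
  ... | is-top = inject₁≢top (trans (sym τn≡a) e)
  ... | is-p = fromℕ≢inject₁ (σ-perm _ _ (trans (trans (sym τa≡σn) e) (sym σa≡a)))
  ... | is-other x≢top x≢a = x≢a (proj₂ unique x (trans (sym (τ≡σ x≢top x≢a)) e))

  τ-longCycle : τ ! (τ ! top) ≢ top
  τ-longCycle e = σn≢n (trans (sym τa≡σn) (trans (cong (τ !_) (sym τn≡a)) e))

  α-τ : α (suc (suc k)) (perm τ) ≡ perm σ
  α-τ = trans (α-longCycle τ τ-longCycle)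
              (cong perm (trans (cong (λ v → f (v , delTop τ)) τn≡a) (lookup-ext λ y → agrees (f-view (delTop τ) a y))))
    where
    agrees : ∀ {y v} → FView (delTop τ) a y v → v ≡ σ ! y
    agrees at-top with top⊎inject₁ (σ ! top)
    ... | inj₁ e = ⊥-elim (σn≢n e)
    ... | inj₂ (b , e) = trans (cong inject₁ (delTop-direct τ {x = a} {y = b} (trans τa≡σn e))) (sym e)
    agrees at-self = sym σa≡a
    agrees (at-pre x x≢a ρx≡a) with delTop-spec τ τ-isPerm x
    ... | inj₁ (e , _) = trans (sym e) (τ≡σ {inject₁ x} inject₁≢top (x≢a ∘′ inject₁-injective))
    ... | inj₂ (e , _) = ⊥-elim (inject₁≢top {j = x} (τ-isPerm _ top (trans e (trans (cong inject₁ ρx≡a) (sym τn≡a)))))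
    agrees (at-other x x≢a ρx≢a) with delTop-spec τ τ-isPerm x
    ... | inj₁ (_ , e) = ⊥-elim (ρx≢a (inject₁-injective (trans (sym e) τn≡a)))
    ... | inj₂ (e , _) = trans (sym e) (τ≡σ {inject₁ x} inject₁≢top (x≢a ∘′ inject₁-injective))

module TwoCyclePreimage {k} (ε : Perm (suc k)) (ε-perm : IsPerm ε) (b : Fin (suc k))
                        (unique : UniqueFixedPoint ε b) where

  τ : Perm (suc (suc k))
  τ = swapTop (f (top , ε)) (inject₁ b)

  private
    τn≡b : τ ! top ≡ inject₁ b
    τn≡b = trans (swapTop-top (f (top , ε)) (inject₁ b)) (trans (f-top-inject₁ ε b) (cong inject₁ (proj₁ unique)))

    τb≡n : τ ! inject₁ b ≡ top
    τb≡n = trans (swapTop-p (f (top , ε)) (inject₁ b) inject₁≢top) (f-top-top ε)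

  τ-isPerm : IsPerm τ
  τ-isPerm = swapTop-isPerm (f (top , ε)) (inject₁ b) (f-top-isPerm ε ε-perm)

  τ-fixedPointFree : FixedPointFree τ
  τ-fixedPointFree x e with position (inject₁ b) x
  ... | is-top = inject₁≢top (trans (sym τn≡b) e)
  ... | is-p = inject₁≢top (trans (sym e) τb≡n)
  ... | is-other x≢top x≢b with top⊎inject₁ x
  ...   | inj₁ x≡top = x≢top x≡top
  ...   | inj₂ (j , refl) = x≢b (cong inject₁ (proj₂ unique j (inject₁-injective
            (trans (sym (f-top-inject₁ ε j)) (trans (sym (swapTop-other (f (top , ε)) (inject₁ b) x≢top x≢b)) e)))))

  τ-2-cycle : τ ! (τ ! top) ≡ top
  τ-2-cycle = trans (cong (τ !_) τn≡b) τb≡n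

  delTop-τ : delTop τ ≡ ε
  delTop-τ = lookup-ext pointwise
    where
    pointwise : ∀ x → delTop τ ! x ≡ ε ! x
    pointwise x with x ≟F b
    ... | yes refl = trans (delTop-bypass τ {x = b} {y = b} τb≡n τn≡b) (sym (proj₁ unique))
    ... | no x≢b = delTop-direct τ {x = x} {y = ε ! x} (trans (swapTop-other (f (top , ε)) (inject₁ b) inject₁≢top (x≢b ∘′ inject₁-injective)) (f-top-inject₁ ε x))

record AlphaBijective (n : ℕ) : Set where
  field
    injective : ∀ {c c′} → c ∈ domα n → c′ ∈ domα n → α n c ≡ α n c′ → c ≡ c′
    image     : ∀ {c} → c ∈ domα n → (α n c ≡ pi × odd n ≡ false) ⊎
                ∃ λ ε → α n c ≡ perm ε × IsPerm ε × ∃ (UniqueFixedPoint ε)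
    onto      : ∀ σ → IsPerm σ → ∀ q → UniqueFixedPoint σ q → ∃ λ c → c ∈ domα n × α n c ≡ perm σ
    α-π-odd   : odd n ≡ true → α n pi ≡ perm (π n)
    α-π-even  : odd n ≡ false → α n (perm (π n)) ≡ pi

module _ {n} (B : AlphaBijective n) where
  open AlphaBijective B

  αInv∘α : ∀ {c} → c ∈ domα n → αInv n (α n c) ≡ c
  αInv∘α c∈ = invBy-unique (α n) (domα n) _ injective c∈ refl

  αInv-preimage : ∀ σ → IsPerm σ → ∀ q → UniqueFixedPoint σ q →
                  αInv n (perm σ) ∈ domα n × α n (αInv n (perm σ)) ≡ perm σ
  αInv-preimage σ σ-perm q unique with onto σ σ-perm q unique
  ... | c , c∈ , αc≡σ = invBy-sound (α n) (domα n) (perm σ) c∈ αc≡σ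

2-cycle-partner : ∀ {k} (τ : Perm (suc (suc k))) → FixedPointFree τ → τ ! (τ ! top) ≡ top →
                  ∃ λ a → τ ! top ≡ inject₁ a × τ ! inject₁ a ≡ top
2-cycle-partner τ free two with top⊎inject₁ (τ ! top)
... | inj₁ e = ⊥-elim (free top e)
... | inj₂ (a , e) = a , e , trans (cong (τ !_) (sym e)) two

longCycle : ∀ {m} (τ : Perm (suc m)) {a} → τ ! top ≡ inject₁ a → τ ! inject₁ a ≢ top → τ ! (τ ! top) ≢ top
longCycle τ n↦a a↛n ττn≡n = a↛n (trans (cong (τ !_) (sym n↦a)) ττn≡n)

2-cycle-determined : ∀ {k} (τ τ′ : Perm (suc (suc k))) a a′ → IsPerm τ → IsPerm τ′ →
                     FixedPointFree τ → FixedPointFree τ′ →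
                     τ ! top ≡ inject₁ a → τ ! inject₁ a ≡ top →
                     τ′ ! top ≡ inject₁ a′ → τ′ ! inject₁ a′ ≡ top →
                     delTop τ ≡ delTop τ′ → τ ≡ τ′
2-cycle-determined τ τ′ a a′ τ-perm τ′-perm free free′ n↦a a↦n n↦a′ a′↦n δ≡δ′ =
  H-injective τ τ′ τ-perm τ′-perm (cong₂ _,_ (trans n↦a (trans (cong inject₁ a≡a′) (sym n↦a′))) δ≡δ′)
  where
  a≡a′ : a ≡ a′
  a≡a′ = sym (proj₂ (delTop-uniqueFixedPoint τ τ-perm free a n↦a a↦n) a′
           (trans (cong (_! a′) δ≡δ′) (proj₁ (delTop-uniqueFixedPoint τ′ τ′-perm free′ a′ n↦a′ a′↦n))))

module Step {k} (B : AlphaBijective (suc k)) where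
  private
    module IH = AlphaBijective B

  p n : ℕ
  p = suc k
  n = suc (suc k)

  odd-p : odd n ≡ false → odd p ≡ true
  odd-p = not-injective {y = true}

  even-p : odd n ≡ true → odd p ≡ false
  even-p = not-injective {y = false}

  αInv-π : odd p ≡ false → αInv p pi ≡ perm (π p)
  αInv-π even = subst (λ t → αInv p t ≡ perm (π p)) (IH.α-π-even even)
                  (αInv∘α B (perm∈domα (∈-allDer⁺ (π-isPerm p) (π-fixedPointFree p even))))

  α-at-π : odd n ≡ true → α n pi ≡ perm (f (top , π p))
  α-at-π odd′ = α-π (π p) odd′ (αInv-π (even-p odd′))

  data Class (c : PX n) : Set where
    via-π : c ≡ pi → odd n ≡ true → α n c ≡ perm (f (top , π p)) → Class c
    long : ∀ τ a → c ≡ perm τ → IsPerm τ → FixedPointFree τ →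
           τ ! top ≡ inject₁ a → τ ! inject₁ a ≢ top →
           α n c ≡ perm (f (inject₁ a , delTop τ)) → Class c
    2-cycle-π : ∀ τ a → c ≡ perm τ → IsPerm τ → FixedPointFree τ →
                τ ! top ≡ inject₁ a → τ ! inject₁ a ≡ top →
                α p pi ≡ perm (delTop τ) → odd p ≡ true → α n c ≡ pi → Class c
    2-cycle : ∀ τ a ρ → c ≡ perm τ → IsPerm τ → FixedPointFree τ →
              τ ! top ≡ inject₁ a → τ ! inject₁ a ≡ top →
              ρ ∈ allDer p → α p (perm ρ) ≡ perm (delTop τ) → α n c ≡ perm (f (top , ρ)) → Class c

  classify-2-cycle : ∀ τ a → IsPerm τ → FixedPointFree τ → τ ! (τ ! top) ≡ top →
                     τ ! top ≡ inject₁ a → τ ! inject₁ a ≡ top →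
                     ∀ {c′} → αInv p (perm (delTop τ)) ≡ c′ → c′ ∈ domα p → α p c′ ≡ perm (delTop τ) →
                     Class (perm τ)
  classify-2-cycle τ a τ-perm free two n↦a a↦n eq c′∈ αc′≡δ with ∈-domα⁻ c′∈
  ... | inj₁ (refl , odd′) = 2-cycle-π τ a refl τ-perm free n↦a a↦n αc′≡δ odd′ (α-2-cycle-π τ two eq)
  ... | inj₂ (ρ , refl , ρ∈) = 2-cycle τ a ρ refl τ-perm free n↦a a↦n ρ∈ αc′≡δ (α-2-cycle τ ρ two eq)

  classify : ∀ {c} → c ∈ domα n → Class c
  classify c∈ with ∈-domα⁻ c∈
  ... | inj₁ (refl , odd′) = via-π refl odd′ (α-at-π odd′)
  ... | inj₂ (τ , refl , τ∈) with ∈-allDer⁻ τ∈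
  ...   | τ-perm , free with τ ! (τ ! top) ≟F top
  ...     | no long′ with top⊎inject₁ (τ ! top)
  ...       | inj₁ e = ⊥-elim (free top e)
  ...       | inj₂ (a , e) = long τ a refl τ-perm free e (λ a↦n → long′ (trans (cong (τ !_) e) a↦n))
                               (trans (α-longCycle τ long′) (cong (λ v → perm (f (v , delTop τ))) e))
  classify c∈ | inj₂ (τ , refl , τ∈) | τ-perm , free | yes two with 2-cycle-partner τ free two
  ...       | a , n↦a , a↦n =
    uncurry (classify-2-cycle τ a τ-perm free two n↦a a↦n refl)
      (αInv-preimage B (delTop τ) (delTop-isPerm τ τ-perm) a (delTop-uniqueFixedPoint τ τ-perm free a n↦a a↦n))

  private
    long-delTop-free : ∀ (τ : Perm n) {a} → IsPerm τ → FixedPointFree τ →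
                       τ ! top ≡ inject₁ a → τ ! inject₁ a ≢ top → FixedPointFree (delTop τ)
    long-delTop-free τ τ-perm free n↦a a↛n = delTop-fixedPointFree τ τ-perm free (longCycle τ n↦a a↛n)

    π-not-2-cycle : ∀ {ρ δ} → odd n ≡ true → α p (perm ρ) ≡ perm δ → f (top , π p) ≢ f (top , ρ)
    π-not-2-cycle {ρ} odd′ αρ≡δ e with f-top-injective (π p) ρ e
    ... | refl = perm≢pi (trans (sym αρ≡δ) (IH.α-π-even (even-p odd′)))

  image : ∀ {c} → c ∈ domα n → (α n c ≡ pi × odd n ≡ false) ⊎
          ∃ λ ε → α n c ≡ perm ε × IsPerm ε × ∃ (UniqueFixedPoint ε)
  image c∈ with classify c∈
  ... | via-π _ odd′ e = inj₂ (_ , e , f-top-isPerm (π p) (π-isPerm p) ,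
                               top , f-top-uniqueFixedPoint (π p) (π-fixedPointFree p (even-p odd′)))
  ... | long τ a _ τ-perm free n↦a a↛n e =
        inj₂ (_ , e , f-inject₁-isPerm (delTop τ) a (delTop-isPerm τ τ-perm) (long-delTop-free τ τ-perm free n↦a a↛n) ,
              inject₁ a , f-inject₁-uniqueFixedPoint (delTop τ) a (long-delTop-free τ τ-perm free n↦a a↛n))
  ... | 2-cycle-π _ _ _ _ _ _ _ _ odd′ e = inj₁ (e , cong not odd′)
  ... | 2-cycle _ _ ρ _ _ _ _ _ ρ∈ _ e =
        inj₂ (_ , e , f-top-isPerm ρ (proj₁ (∈-allDer⁻ ρ∈)) , top , f-top-uniqueFixedPoint ρ (proj₂ (∈-allDer⁻ ρ∈)))

  separate : ∀ {c c′} → Class c → Class c′ → α n c ≡ α n c′ → c ≡ c′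
  separate (via-π refl _ _) (via-π refl _ _) _ = refl
  separate (via-π _ _ x) (long _ a _ _ _ _ _ y) e =
    ⊥-elim (f-inject₁≢f-top _ _ a (sym (perm-injective (trans (sym x) (trans e y)))))
  separate (via-π _ _ x) (2-cycle-π _ _ _ _ _ _ _ _ _ y) e = ⊥-elim (perm≢pi (trans (sym x) (trans e y)))
  separate (via-π _ odd′ x) (2-cycle _ _ _ _ _ _ _ _ _ αρ y) e =
    ⊥-elim (π-not-2-cycle odd′ αρ (perm-injective (trans (sym x) (trans e y))))
  separate (long _ a _ _ _ _ _ y) (via-π _ _ x) e =
    ⊥-elim (f-inject₁≢f-top _ _ a (perm-injective (trans (sym y) (trans e x))))
  separate (long τ a refl τ-perm free n↦a a↛n y) (long τ′ a′ refl τ′-perm free′ n↦a′ a′↛n y′) e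
    with f-inject₁-injective _ _ a a′ (long-delTop-free τ τ-perm free n↦a a↛n) (long-delTop-free τ′ τ′-perm free′ n↦a′ a′↛n)
           (perm-injective (trans (sym y) (trans e y′)))
  ... | refl , δ≡δ′ = cong perm (H-injective τ τ′ τ-perm τ′-perm (cong₂ _,_ (trans n↦a (sym n↦a′)) δ≡δ′))
  separate (long _ _ _ _ _ _ _ y) (2-cycle-π _ _ _ _ _ _ _ _ _ y′) e = ⊥-elim (perm≢pi (trans (sym y) (trans e y′)))
  separate (long _ a _ _ _ _ _ y) (2-cycle _ _ _ _ _ _ _ _ _ _ y′) e =
    ⊥-elim (f-inject₁≢f-top _ _ a (perm-injective (trans (sym y) (trans e y′))))
  separate (2-cycle-π _ _ _ _ _ _ _ _ _ y) (via-π _ _ x) e = ⊥-elim (perm≢pi (trans (sym x) (trans (sym e) y)))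
  separate (2-cycle-π _ _ _ _ _ _ _ _ _ y) (long _ _ _ _ _ _ _ y′) e = ⊥-elim (perm≢pi (trans (sym y′) (trans (sym e) y)))
  separate (2-cycle-π τ a refl τ-perm free n↦a a↦n x _ _) (2-cycle-π τ′ a′ refl τ′-perm free′ n↦a′ a′↦n x′ _ _) _ =
    cong perm (2-cycle-determined τ τ′ a a′ τ-perm τ′-perm free free′ n↦a a↦n n↦a′ a′↦n (perm-injective (trans (sym x) x′)))
  separate (2-cycle-π _ _ _ _ _ _ _ _ _ y) (2-cycle _ _ _ _ _ _ _ _ _ _ y′) e = ⊥-elim (perm≢pi (trans (sym y′) (trans (sym e) y)))
  separate (2-cycle _ _ _ _ _ _ _ _ _ αρ y) (via-π _ odd′ x) e =
    ⊥-elim (π-not-2-cycle odd′ αρ (perm-injective (trans (sym x) (trans (sym e) y))))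
  separate (2-cycle _ _ _ _ _ _ _ _ _ _ y) (long _ a _ _ _ _ _ y′) e =
    ⊥-elim (f-inject₁≢f-top _ _ a (perm-injective (trans (sym y′) (trans (sym e) y))))
  separate (2-cycle _ _ _ _ _ _ _ _ _ _ y) (2-cycle-π _ _ _ _ _ _ _ _ _ y′) e = ⊥-elim (perm≢pi (trans (sym y) (trans e y′)))
  separate (2-cycle τ a ρ refl τ-perm free n↦a a↦n _ x y) (2-cycle τ′ a′ ρ′ refl τ′-perm free′ n↦a′ a′↦n _ x′ y′) e
    with f-top-injective ρ ρ′ (perm-injective (trans (sym y) (trans e y′)))
  ... | refl = cong perm (2-cycle-determined τ τ′ a a′ τ-perm τ′-perm free free′ n↦a a↦n n↦a′ a′↦n
                            (perm-injective (trans (sym x) x′)))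

  injective : ∀ {c c′} → c ∈ domα n → c′ ∈ domα n → α n c ≡ α n c′ → c ≡ c′
  injective c∈ c′∈ = separate (classify c∈) (classify c′∈)

  onto-topFixed : ∀ σ → IsPerm σ → UniqueFixedPoint σ top → ∃ λ c → c ∈ domα n × α n c ≡ perm σ
  onto-topFixed σ σ-perm unique = from-image (IH.image (perm∈domα δ∈))
    where
    δ = delTop σ
    δ∈ : δ ∈ allDer p
    δ∈ = ∈-allDer⁺ (delTop-isPerm σ σ-perm) (delTop-fixedPointFree-topFixed σ σ-perm unique)
    f-top-δ≡σ : perm (f (top , δ)) ≡ perm σ
    f-top-δ≡σ = cong perm (f-top∘delTop σ σ-perm (proj₁ unique))
    αInv-at : ∀ {t} → α p (perm δ) ≡ t → αInv p t ≡ perm δ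
    αInv-at αδ≡t = subst (λ t → αInv p t ≡ perm δ) αδ≡t (αInv∘α B (perm∈domα δ∈))
    from-image : (α p (perm δ) ≡ pi × odd p ≡ false) ⊎
                 (∃ λ ε → α p (perm δ) ≡ perm ε × IsPerm ε × ∃ (UniqueFixedPoint ε)) →
                 ∃ λ c → c ∈ domα n × α n c ≡ perm σ
    from-image (inj₁ (αδ≡pi , even)) =
      pi , pi∈domα (cong not even) , trans (α-π δ (cong not even) (αInv-at αδ≡pi)) f-top-δ≡σ
    from-image (inj₂ (ε , αδ≡ε , ε-perm , b , ε-unique)) =
      perm τ , perm∈domα (∈-allDer⁺ τ-isPerm τ-fixedPointFree) ,
      trans (α-2-cycle τ δ τ-2-cycle (αInv-at (trans αδ≡ε (cong perm (sym delTop-τ))))) f-top-δ≡σ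
      where open TwoCyclePreimage ε ε-perm b ε-unique

  onto : ∀ σ → IsPerm σ → ∀ q → UniqueFixedPoint σ q → ∃ λ c → c ∈ domα n × α n c ≡ perm σ
  onto σ σ-perm q unique with top⊎inject₁ q
  ... | inj₁ refl = onto-topFixed σ σ-perm unique
  ... | inj₂ (a , refl) = perm τ , perm∈domα (∈-allDer⁺ τ-isPerm τ-fixedPointFree) , α-τ
    where open LongCyclePreimage σ σ-perm a unique

  bijective : AlphaBijective n
  bijective = record
    { injective = injective
    ; image     = image
    ; onto      = onto
    ; α-π-odd   = λ odd′ → trans (α-at-π odd′) (cong perm (f-top-π p (even-p odd′)))
    ; α-π-even  = λ even → α-2-cycle-π (π n) (π-top-2-cycle k (odd-p even))
        (subst (λ t → αInv p t ≡ pi) (trans (IH.α-π-odd (odd-p even)) (cong perm (sym (delTop-π k (odd-p even)))))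
               (αInv∘α B (pi∈domα (odd-p even))))
    }

Fin1-zero : (x : Fin 1) → x ≡ zero
Fin1-zero zero = refl

α-bijective-1 : AlphaBijective 1
α-bijective-1 = record
  { injective = λ c∈ c′∈ _ → trans (only-pi c∈) (sym (only-pi c′∈))
  ; image     = λ c∈ → image (only-pi c∈)
  ; onto      = onto
  ; α-π-odd   = λ _ → refl
  ; α-π-even  = λ ()
  }
  where
  only-pi : ∀ {c} → c ∈ domα 1 → c ≡ pi
  only-pi c∈ with ∈-domα⁻ c∈
  ... | inj₁ (c≡pi , _) = c≡pi
  ... | inj₂ (τ , _ , τ∈) = ⊥-elim (proj₂ (∈-allDer⁻ τ∈) zero (Fin1-zero _))

  image : ∀ {c} → c ≡ pi → (α 1 c ≡ pi × odd 1 ≡ false) ⊎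
          ∃ λ ε → α 1 c ≡ perm ε × IsPerm ε × ∃ (UniqueFixedPoint ε)
  image refl = inj₂ (zero ∷ [] , refl , (λ x y _ → trans (Fin1-zero x) (sym (Fin1-zero y))) ,
                     zero , refl , λ y _ → Fin1-zero y)

  onto : ∀ σ → IsPerm σ → ∀ q → UniqueFixedPoint σ q → ∃ λ c → c ∈ domα 1 × α 1 c ≡ perm σ
  onto (a ∷ []) _ _ _ rewrite Fin1-zero a = pi , here refl , refl

α-bijective : ∀ k → AlphaBijective (suc k)
α-bijective zero = α-bijective-1
α-bijective (suc k) = Step.bijective (α-bijective k)

-- Y_n = Z_n

YAgreesWithZ : ∀ {m} → Perm (suc m) → Set
YAgreesWithZ {m} σ = Σ (Fin (suc m) × Perm m) (λ z → (Z σ ≡ just z) × Runs (H σ) z)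

Z-oneFixed : ∀ {m} (σ : Perm (suc m)) → OneFixed σ → Z σ ≡ ζX (αInv (suc m) (perm σ))
Z-oneFixed σ one = cong ζX (if-true (isYes-true (nfix σ ≟ℕ 1) one))

ζ-nonDerangement : ∀ {m} (σ : Perm (suc m)) → ¬ Derangement σ → ζ σ ≡ H σ
ζ-nonDerangement σ ¬der = if-false (isYes-false (nfix σ ≟ℕ 0) ¬der)

ζ-2-cycle : ∀ {m} (τ : Perm (suc m)) → FixedPointFree τ → τ ! (τ ! top) ≡ top → ζ τ ≡ H τ
ζ-2-cycle τ free two =
  trans (if-true (isYes-true (nfix τ ≟ℕ 0) (fixedPointFree⇒derangement τ free))) (if-true (≡⇒== two))

ζ-longCycle : ∀ {m} (τ : Perm (suc m)) → FixedPointFree τ → τ ! (τ ! top) ≢ top →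
              ζ τ ≡ (τ ! (τ ! top) , ζρ τ)
ζ-longCycle τ free long =
  trans (if-true (isYes-true (nfix τ ≟ℕ 0) (fixedPointFree⇒derangement τ free))) (if-false (≢⇒== long))

runs-stop : ∀ {m} {y : Fin (suc m) × Perm m} x → proj₂ y ! x ≡ x → Runs y y
runs-stop {y = y} x fixed = stop (λ der → derangement⇒fixedPointFree (proj₂ y) der x fixed)

agree-manyFixed : ∀ {m} (σ : Perm (suc m)) → ¬ Derangement σ → ¬ OneFixed σ → YAgreesWithZ σ
agree-manyFixed σ ¬der ¬one with fixedPoint-below-top σ ¬der ¬one
... | x , fixed =
  H σ , trans (cong ζX (if-false (isYes-false (nfix σ ≟ℕ 1) ¬one))) (cong just (ζ-nonDerangement σ ¬der)) ,
  runs-stop x (delTop-direct σ fixed)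

agree-longCycle : ∀ {k} (σ τ : Perm (suc (suc k))) a → IsPerm τ → FixedPointFree τ →
                  τ ! top ≡ inject₁ a → τ ! inject₁ a ≢ top → OneFixed σ →
                  αInv (suc (suc k)) (perm σ) ≡ perm τ → f (inject₁ a , delTop τ) ≡ σ → YAgreesWithZ σ
agree-longCycle σ τ a τ-perm free n↦a a↛n one αInvσ≡τ refl =
  (τ ! (τ ! top) , ζρ τ) ,
  trans (Z-oneFixed σ one) (trans (cong ζX αInvσ≡τ) (cong just (ζ-longCycle τ free (longCycle τ n↦a a↛n)))) ,
  subst (λ y → Runs y (τ ! (τ ! top) , ζρ τ)) (sym Hσ≡ζτ)
    (runs-stop a (subst (λ δ → δ ! a ≡ a) (cong proj₂ Hσ≡ζτ) (delTop-f-inject₁-fixed (delTop τ) a)))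
  where
  Hσ≡ζτ : H σ ≡ (τ ! (τ ! top) , ζρ τ)
  Hσ≡ζτ = H-f-longCycle τ τ-perm a n↦a a↛n

agree-2-cycle : ∀ {k} (σ τ : Perm (suc (suc k))) a ρ → FixedPointFree τ →
                τ ! top ≡ inject₁ a → τ ! inject₁ a ≡ top → FixedPointFree ρ → OneFixed σ →
                αInv (suc (suc k)) (perm σ) ≡ perm τ → f (top , ρ) ≡ σ → YAgreesWithZ σ
agree-2-cycle σ τ a ρ free n↦a a↦n ρ-free one αInvσ≡τ refl =
  H τ ,
  trans (Z-oneFixed σ one) (trans (cong ζX αInvσ≡τ) (cong just (ζ-2-cycle τ free two))) ,
  next τ (subst Derangement (sym (delTop∘f-top ρ)) (fixedPointFree⇒derangement ρ ρ-free))
         (cong asPerm (trans (cong (λ s → αInv _ (perm s)) f∘H≡id) αInvσ≡τ))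
         (runs-stop a (delTop-bypass τ a↦n n↦a))
  where
  two : τ ! (τ ! top) ≡ top
  two = trans (cong (τ !_) n↦a) a↦n
  f∘H≡id : f (H σ) ≡ σ
  f∘H≡id = cong f (cong₂ _,_ (f-top-top ρ) (delTop∘f-top ρ))

agree-oneFixed : ∀ k (σ : Perm (suc (suc k))) → IsPerm σ → OneFixed σ →
                 (odd (suc (suc k)) ≡ true → σ ≢ π (suc (suc k))) → YAgreesWithZ σ
agree-oneFixed k σ σ-perm one σ≢π with uniqueFixedPoint σ one
... | q , unique with αInv-preimage (α-bijective (suc k)) σ σ-perm q unique
...   | c∈ , αc≡σ = from-class refl (classify c∈) αc≡σ
  where
  open Step (α-bijective k)
  open AlphaBijective (α-bijective (suc k)) using (α-π-odd)
  from-class : ∀ {c} → αInv n (perm σ) ≡ c → Class c → α n c ≡ perm σ → YAgreesWithZ σ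
  from-class _ (via-π refl odd′ _) αpi≡σ = ⊥-elim (σ≢π odd′ (perm-injective (trans (sym αpi≡σ) (α-π-odd odd′))))
  from-class _ (2-cycle-π _ _ _ _ _ _ _ _ _ αc≡pi) αc≡σ = ⊥-elim (perm≢pi (trans (sym αc≡σ) αc≡pi))
  from-class eq (long τ a refl τ-perm free n↦a a↛n αc) αc≡σ =
    agree-longCycle σ τ a τ-perm free n↦a a↛n one eq (perm-injective (trans (sym αc) αc≡σ))
  from-class eq (2-cycle τ a ρ refl _ free n↦a a↦n ρ∈ _ αc) αc≡σ =
    agree-2-cycle σ τ a ρ free n↦a a↦n (proj₂ (∈-allDer⁻ ρ∈)) one eq (perm-injective (trans (sym αc) αc≡σ))

oneFixed-or-not : ∀ {n} (σ : Perm n) → OneFixed σ ⊎ ¬ OneFixed σ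
oneFixed-or-not σ with nfix σ ≟ℕ 1
... | yes one = inj₁ one
... | no ¬one = inj₂ ¬one

Perm1≡π : (σ : Perm 1) → σ ≡ π 1
Perm1≡π (a ∷ []) = cong (_∷ []) (Fin1-zero a)

theorem3 : (m : ℕ) (σ : Perm (suc m)) → IsPerm σ → ¬ Derangement σ →
           (odd (suc m) ≡ true → σ ≢ π (suc m)) →
           Σ (Fin (suc m) × Perm m) (λ z → (Z σ ≡ just z) × Runs (H σ) z)
theorem3 zero σ _ _ σ≢π = ⊥-elim (σ≢π refl (Perm1≡π σ))
theorem3 (suc k) σ σ-perm ¬der σ≢π with oneFixed-or-not σ
... | inj₁ one = agree-oneFixed k σ σ-perm one σ≢π
... | inj₂ ¬one = agree-manyFixed σ ¬der ¬one
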